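{- Let $\mathbf{A}=\langle A,\wedge,\vee,\neg,J_2,0,1\rangle$ be a Bochvar algebra, and let $\mathrm{P}_{\!\!\!\text{\l}}(\mathbf{A}_i)_{i\in I}$ be the Płonka sum decomposition of its involutive bisemilattice reduct, with index semilattice $\langle I,\vee,i_0\rangle$. Let $K=\{J_2^{\mathbf{A}}(1^{\mathbf{A}_i}) : i\in I\}$, where $1^{\mathbf{A}_i}$ is the top element of the Boolean fibre $\mathbf{A}_i$, ordered by $J_2(1^{\mathbf{A}_i})\le_{\mathbf{K}} J_2(1^{\mathbf{A}_j})$ iff $j\le_I i$. Then $\mathbb{B}_{\mathbf{A}}:=\langle\mathbf{A}_{i_0},\mathbf{K}\rangle$ is a Bochvar system, i.e. $\mathbf{A}_{i_0}$ is a Boolean algebra and $K$ is a subset of $A_{i_0}$ containing $1$ and closed under the meet of $\mathbf{A}_{i_0}$.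
   Context: Bochvar algebras: let $\mathbf{WK}^e$ be the algebra on $\{0,\tfrac12,1\}$ of type $\langle\wedge,\vee,\neg,J_2,0,1\rangle$ where $\neg 0=1,\neg\tfrac12=\tfrac12,\neg1=0$; $\vee,\wedge$ are Boolean on $\{0,1\}$ and output $\tfrac12$ whenever an argument is $\tfrac12$; $J_2 1=1$, $J_2\tfrac12=J_20=0$. Bochvar algebras form the quasivariety $ISP(\mathbf{WK}^e)$. Every Bochvar algebra has an involutive bisemilattice reduct $\langle A,\wedge,\vee,\neg,0,1\rangle$, and every involutive bisemilattice is (up to isomorphism, uniquely) the Płonka sum of a semilattice direct system of Boolean algebras $\{\mathbf{A}_i\}_{i\in I}$ over a lower-bounded join-semilattice $\langle I,\vee,i_0\rangle$ with homomorphisms $p_{ij}:\mathbf{A}_i\to\mathbf{A}_j$ ($i\le j$); in the Płonka sum, operations on elements from fibres $A_{i_1},\dots,A_{i_n}$ are computed in the fibre $A_{i_1\vee\dots\vee i_n}$ after applying the $p$'s, and constants lie in $\mathbf{A}_{i_0}$. A Bochvar system is a pair $\langle\mathbf{B},\mathbf{I}\rangle$ with $\mathbf{B}$ a Boolean algebra and $\mathbf{I}=\langle I,\wedge,1\rangle$ a meet-subsemilattice with unit of $\mathbf{B}$. -}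

module Defs where

open import Data.Product using (Σ; ∃; _,_; proj₁; proj₂)
open import Relation.Binary.PropositionalEquality
  using (_≡_; refl; sym; trans; cong)
open import Relation.Binary.PropositionalEquality.Properties using ()
import Algebra.Structures as AS
import Algebra.Lattice.Structures as ALS

data Three : Set where
  𝟘 ½ 𝟙 : Three

_∧₃_ : Three → Three → Three
½ ∧₃ _ = ½
_ ∧₃ ½ = ½
𝟘 ∧₃ _ = 𝟘
𝟙 ∧₃ y = y

_∨₃_ : Three → Three → Three
½ ∨₃ _ = ½
_ ∨₃ ½ = ½
𝟙 ∨₃ _ = 𝟙
𝟘 ∨₃ y = y

¬₃ : Three → Three
¬₃ 𝟘 = 𝟙
¬₃ ½ = ½
¬₃ 𝟙 = 𝟘

J₂₃ : Three → Three
J₂₃ 𝟙 = 𝟙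
J₂₃ ½ = 𝟘
J₂₃ 𝟘 = 𝟘

record BAlg : Set₁ where
  field
    Carrier : Set
    _∧_ _∨_ : Carrier → Carrier → Carrier
    ¬_ J₂   : Carrier → Carrier
    𝟎 𝟏     : Carrier

-- A ∈ ISP(WK^e): A embeds (injective homomorphism) into a power
-- (WK^e)^X = X → Three, for some index set X.  Equality in the power is
-- pointwise.
record InISP-WKe (A : BAlg) : Set₁ where
  open BAlg A
  field
    X     : Set
    h     : Carrier → X → Three
    inj   : ∀ a b → (∀ x → h a x ≡ h b x) → a ≡ b
    h-∧   : ∀ a b x → h (a ∧ b) x ≡ (h a x ∧₃ h b x)
    h-∨   : ∀ a b x → h (a ∨ b) x ≡ (h a x ∨₃ h b x)
    h-¬   : ∀ a x → h (¬ a) x ≡ ¬₃ (h a x)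
    h-J₂  : ∀ a x → h (J₂ a) x ≡ J₂₃ (h a x)
    h-𝟎   : ∀ x → h 𝟎 x ≡ 𝟘
    h-𝟏   : ∀ x → h 𝟏 x ≡ 𝟙

record LBJoinSemilattice : Set₁ where
  field
    I      : Set
    _⊔_    : I → I → I
    i₀     : I
    isSemilattice : AS.IsCommutativeBand (_≡_ {A = I}) _⊔_
    i₀-bot : ∀ i → i₀ ⊔ i ≡ i

  _≤_ : I → I → Set
  i ≤ j = i ⊔ j ≡ j

  open AS.IsCommutativeBand isSemilattice public
    using (assoc; comm; idem)

  ≤-⊔ˡ : ∀ i j → i ≤ (i ⊔ j)
  ≤-⊔ˡ i j = trans (sym (assoc i i j)) (cong (_⊔ j) (idem i))

  ≤-⊔ʳ : ∀ i j → j ≤ (i ⊔ j)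
  ≤-⊔ʳ i j = trans (cong (j ⊔_) (comm i j)) (trans (≤-⊔ˡ j i) (comm j i))

-- A semilattice direct system of Boolean algebras over ⟨I, ⊔, i₀⟩.
-- Boolean algebra structure on each fibre: stdlib's IsBooleanAlgebra
-- (argument order: ∨ ∧ ¬ ⊤ ⊥) with propositional equality.
record DirectSystem (L : LBJoinSemilattice) : Set₁ where
  open LBJoinSemilattice L
  field
    A    : I → Set
    ∨ᵢ ∧ᵢ : ∀ i → A i → A i → A i
    ¬ᵢ   : ∀ i → A i → A i
    ⊤ᵢ ⊥ᵢ : ∀ i → A i
    isBA : ∀ i → ALS.IsBooleanAlgebra (_≡_ {A = A i}) (∨ᵢ i) (∧ᵢ i) (¬ᵢ i) (⊤ᵢ i) (⊥ᵢ i)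
    p    : ∀ {i j} → i ≤ j → A i → A j
    p-∨  : ∀ {i j} (e : i ≤ j) a b → p e (∨ᵢ i a b) ≡ ∨ᵢ j (p e a) (p e b)
    p-∧  : ∀ {i j} (e : i ≤ j) a b → p e (∧ᵢ i a b) ≡ ∧ᵢ j (p e a) (p e b)
    p-¬  : ∀ {i j} (e : i ≤ j) a → p e (¬ᵢ i a) ≡ ¬ᵢ j (p e a)
    p-⊤  : ∀ {i j} (e : i ≤ j) → p e (⊤ᵢ i) ≡ ⊤ᵢ j
    p-⊥  : ∀ {i j} (e : i ≤ j) → p e (⊥ᵢ i) ≡ ⊥ᵢ j
    p-id   : ∀ {i} (e : i ≤ i) a → p e a ≡ a
    p-comp : ∀ {i j k} (e₁ : i ≤ j) (e₂ : j ≤ k) (e₃ : i ≤ k) a →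
             p e₂ (p e₁ a) ≡ p e₃ a

  Pł : Set
  Pł = Σ I A

  _∧ₚ_ : Pł → Pł → Pł
  (i , a) ∧ₚ (j , b) = (i ⊔ j) , ∧ᵢ (i ⊔ j) (p (≤-⊔ˡ i j) a) (p (≤-⊔ʳ i j) b)

  _∨ₚ_ : Pł → Pł → Pł
  (i , a) ∨ₚ (j , b) = (i ⊔ j) , ∨ᵢ (i ⊔ j) (p (≤-⊔ˡ i j) a) (p (≤-⊔ʳ i j) b)

  ¬ₚ : Pł → Pł
  ¬ₚ (i , a) = i , ¬ᵢ i a

  𝟎ₚ 𝟏ₚ : Pł
  𝟎ₚ = i₀ , ⊥ᵢ i₀
  𝟏ₚ = i₀ , ⊤ᵢ i₀

  top : I → Pł
  top i = i , ⊤ᵢ i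

  withJ₂ : (Pł → Pł) → BAlg
  withJ₂ J = record
    { Carrier = Pł ; _∧_ = _∧ₚ_ ; _∨_ = _∨ₚ_ ; ¬_ = ¬ₚ ; J₂ = J
    ; 𝟎 = 𝟎ₚ ; 𝟏 = 𝟏ₚ }

{-# OPTIONS --safe #-}
-- WK^e satisfies the identities J₂x ∨ ¬J₂x ≈ 1, J₂1 ≈ 1 and J₂(x ∧ y) ≈ J₂x ∧ J₂y,
-- hence so does every Bochvar algebra.  In a Płonka sum x ∨ ¬x lies in the fibre
-- of x, so the first identity puts every J₂ a in the fibre of 1, which is A_{i₀}.
-- Since 1^{A_i} ∧ 1^{A_j} = 1^{A_{i ∨ j}}, the other two identities give 1 ∈ K
-- and closure of K under meet.
module Submission where

open import Defs
open import Data.Product using (Σ; _×_; _,_; proj₁)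
open import Level using (0ℓ)
open import Relation.Binary.PropositionalEquality using (_≡_; refl; sym; cong; cong₂; module ≡-Reasoning)
open import Algebra.Lattice.Structures using (IsBooleanAlgebra)
open import Algebra.Lattice.Bundles using (BooleanAlgebra)
import Algebra.Lattice.Properties.BooleanAlgebra as BooleanAlgebraProperties

J₂₃-excluded-middle : ∀ t → (J₂₃ t ∨₃ ¬₃ (J₂₃ t)) ≡ 𝟙
J₂₃-excluded-middle 𝟘 = refl
J₂₃-excluded-middle ½ = refl
J₂₃-excluded-middle 𝟙 = refl

J₂₃-∧₃ : ∀ s t → J₂₃ (s ∧₃ t) ≡ (J₂₃ s ∧₃ J₂₃ t)
J₂₃-∧₃ 𝟘 𝟘 = refl
J₂₃-∧₃ 𝟘 ½ = refl
J₂₃-∧₃ 𝟘 𝟙 = refl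
J₂₃-∧₃ ½ 𝟘 = refl
J₂₃-∧₃ ½ ½ = refl
J₂₃-∧₃ ½ 𝟙 = refl
J₂₃-∧₃ 𝟙 𝟘 = refl
J₂₃-∧₃ 𝟙 ½ = refl
J₂₃-∧₃ 𝟙 𝟙 = refl

module _ {𝐀 : BAlg} (isp : InISP-WKe 𝐀) where
  open BAlg 𝐀
  open InISP-WKe isp
  open ≡-Reasoning

  J₂-𝟏 : J₂ 𝟏 ≡ 𝟏
  J₂-𝟏 = inj _ _ λ x → begin
    h (J₂ 𝟏) x    ≡⟨ h-J₂ 𝟏 x ⟩
    J₂₃ (h 𝟏 x)   ≡⟨ cong J₂₃ (h-𝟏 x) ⟩
    𝟙             ≡⟨ sym (h-𝟏 x) ⟩
    h 𝟏 x         ∎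

  J₂-excluded-middle : ∀ a → (J₂ a ∨ (¬ (J₂ a))) ≡ 𝟏
  J₂-excluded-middle a = inj _ _ λ x → begin
    h (J₂ a ∨ (¬ (J₂ a))) x            ≡⟨ h-∨ (J₂ a) (¬ (J₂ a)) x ⟩
    h (J₂ a) x ∨₃ h (¬ (J₂ a)) x       ≡⟨ cong (h (J₂ a) x ∨₃_) (h-¬ (J₂ a) x) ⟩
    h (J₂ a) x ∨₃ ¬₃ (h (J₂ a) x)      ≡⟨ cong (λ t → t ∨₃ ¬₃ t) (h-J₂ a x) ⟩
    J₂₃ (h a x) ∨₃ ¬₃ (J₂₃ (h a x))    ≡⟨ J₂₃-excluded-middle (h a x) ⟩
    𝟙                                  ≡⟨ sym (h-𝟏 x) ⟩
    h 𝟏 x                              ∎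

  J₂-∧ : ∀ a b → J₂ (a ∧ b) ≡ (J₂ a ∧ J₂ b)
  J₂-∧ a b = inj _ _ λ x → begin
    h (J₂ (a ∧ b)) x                 ≡⟨ h-J₂ (a ∧ b) x ⟩
    J₂₃ (h (a ∧ b) x)                ≡⟨ cong J₂₃ (h-∧ a b x) ⟩
    J₂₃ (h a x ∧₃ h b x)             ≡⟨ J₂₃-∧₃ (h a x) (h b x) ⟩
    J₂₃ (h a x) ∧₃ J₂₃ (h b x)       ≡⟨ sym (cong₂ _∧₃_ (h-J₂ a x) (h-J₂ b x)) ⟩
    h (J₂ a) x ∧₃ h (J₂ b) x         ≡⟨ sym (h-∧ (J₂ a) (J₂ b) x) ⟩
    h (J₂ a ∧ J₂ b) x                ∎

module _ {L : LBJoinSemilattice} (S : DirectSystem L) where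
  open LBJoinSemilattice L
  open DirectSystem S

  fibreBooleanAlgebra : I → BooleanAlgebra 0ℓ 0ℓ
  fibreBooleanAlgebra i = record { isBooleanAlgebra = isBA i }

  top-∧ₚ : ∀ i j → (top i ∧ₚ top j) ≡ top (i ⊔ j)
  top-∧ₚ i j = cong (i ⊔ j ,_) (begin
    ∧ᵢ (i ⊔ j) (p (≤-⊔ˡ i j) (⊤ᵢ i)) (p (≤-⊔ʳ i j) (⊤ᵢ j))   ≡⟨ cong₂ (∧ᵢ (i ⊔ j)) (p-⊤ _) (p-⊤ _) ⟩
    ∧ᵢ (i ⊔ j) (⊤ᵢ (i ⊔ j)) (⊤ᵢ (i ⊔ j))                      ≡⟨ ∧-idem (⊤ᵢ (i ⊔ j)) ⟩
    ⊤ᵢ (i ⊔ j)                                                ∎)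
    where
    open ≡-Reasoning
    open BooleanAlgebraProperties (fibreBooleanAlgebra (i ⊔ j)) using (∧-idem)

  ∨ₚ-¬ₚ≡𝟏ₚ⇒fibre≡i₀ : ∀ x → (x ∨ₚ ¬ₚ x) ≡ 𝟏ₚ → proj₁ x ≡ i₀
  ∨ₚ-¬ₚ≡𝟏ₚ⇒fibre≡i₀ (k , _) eq = begin
    k       ≡⟨ sym (idem k) ⟩
    k ⊔ k   ≡⟨ cong proj₁ eq ⟩
    i₀      ∎
    where open ≡-Reasoning

theorem3p4 : (L : LBJoinSemilattice) (S : DirectSystem L) (J : DirectSystem.Pł S → DirectSystem.Pł S) →
    InISP-WKe (DirectSystem.withJ₂ S J) →
    IsBooleanAlgebra (_≡_ {A = DirectSystem.A S (LBJoinSemilattice.i₀ L)})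
      (DirectSystem.∨ᵢ S (LBJoinSemilattice.i₀ L)) (DirectSystem.∧ᵢ S (LBJoinSemilattice.i₀ L))
      (DirectSystem.¬ᵢ S (LBJoinSemilattice.i₀ L)) (DirectSystem.⊤ᵢ S (LBJoinSemilattice.i₀ L))
      (DirectSystem.⊥ᵢ S (LBJoinSemilattice.i₀ L))
    × (∀ i → proj₁ (J (DirectSystem.top S i)) ≡ LBJoinSemilattice.i₀ L)
    × (Σ (LBJoinSemilattice.I L) λ i → J (DirectSystem.top S i) ≡ DirectSystem.𝟏ₚ S)
    × (∀ i j → Σ (LBJoinSemilattice.I L) λ k →
         J (DirectSystem.top S k) ≡ DirectSystem._∧ₚ_ S (J (DirectSystem.top S i)) (J (DirectSystem.top S j)))
theorem3p4 L S J isp =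
  isBA i₀ ,
  (λ i → ∨ₚ-¬ₚ≡𝟏ₚ⇒fibre≡i₀ S (J (top i)) (J₂-excluded-middle isp (top i))) ,
  (i₀ , J₂-𝟏 isp) ,
  λ i j → i ⊔ j , J-top-∧ i j
  where
  open LBJoinSemilattice L
  open DirectSystem S
  open ≡-Reasoning

  J-top-∧ : ∀ i j → J (top (i ⊔ j)) ≡ (J (top i) ∧ₚ J (top j))
  J-top-∧ i j = begin
    J (top (i ⊔ j))           ≡⟨ cong J (sym (top-∧ₚ S i j)) ⟩
    J (top i ∧ₚ top j)        ≡⟨ J₂-∧ isp (top i) (top j) ⟩
    J (top i) ∧ₚ J (top j)    ∎
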